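{- For any finite poset $P$ with $n$ elements and any antichain $A$ of $P$, $$\sum_{x\in A}\mathrm{win}(x)\ge \frac{(n+1)|A|^2}{n}.$$
   Context: $f$ is a uniformly random linear extension of $P$ (order-preserving bijection $P\to\{1,\dots,n\}$). For $x\in P$, $r(x)=\min\{f(y):y>x\}$ (equal to $n+1$ if $x$ is maximal), $q(x)=\max\{f(y):y<x\}$ (equal to $0$ if $x$ is minimal), and $\mathrm{win}(x)=\mathbb{E}[r(x)-q(x)]$. -}

module Defs where

open import Data.Nat as ℕ using (ℕ; zero; suc; _⊓_; _⊔_)
open import Data.Fin as Fin using (Fin; toℕ)
open import Data.Fin.Properties using (all?; any?)
import Data.Fin.Properties as FinP
open import Data.Fin.Subset using (Subset; _∈_)
open import Data.Fin.Subset.Properties using (_∈?_)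
open import Data.List using (List; []; _∷_; map; filter; foldr; concatMap; length)
open import Data.List.Base using (allFin)
open import Data.Product using (_×_; _,_; ∃)
open import Data.Rational as ℚ using (ℚ; 0ℚ; _+_; _-_; _*_)
open import Data.Integer using (+_)
open import Relation.Binary.PropositionalEquality using (_≡_; _≢_)
open import Relation.Binary.Structures using (IsDecPartialOrder)
open import Relation.Nullary using (Dec; ¬_; ¬?)
open import Relation.Nullary.Decidable using (_×-dec_; _→-dec_)

-- A finite poset with n elements is represented (up to isomorphism) as a
-- decidable partial order _≼_ on Fin n.

module _ {n : ℕ} (_≼_ : Fin n → Fin n → Set)
         (isDPO : IsDecPartialOrder _≡_ _≼_) where

  open IsDecPartialOrder isDPO using (_≤?_)

  _≺_ : Fin n → Fin n → Set
  x ≺ y = x ≼ y × x ≢ y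

  _≺?_ : (x y : Fin n) → Dec (x ≺ y)
  x ≺? y = (x ≤? y) ×-dec ¬? (x Fin.≟ y)

  -- value of f at x, read as an element of {1,…,n}
  val : (Fin n → Fin n) → Fin n → ℕ
  val f x = suc (toℕ (f x))

  IsLinExt : (Fin n → Fin n) → Set
  IsLinExt f = (∀ x y → f x ≡ f y → x ≡ y)
             × (∀ y → ∃ λ x → f x ≡ y)
             × (∀ x y → x ≼ y → val f x ℕ.≤ val f y)

  isLinExt? : (f : Fin n → Fin n) → Dec (IsLinExt f)
  isLinExt? f =
    all? (λ x → all? (λ y → (f x Fin.≟ f y) →-dec (x Fin.≟ y)))
    ×-dec (all? (λ y → any? (λ x → f x Fin.≟ y))
    ×-dec all? (λ x → all? (λ y → (x ≤? y) →-dec (val f x ℕ.≤? val f y))))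

  r : (Fin n → Fin n) → Fin n → ℕ
  r f x = foldr _⊓_ (suc n) (map (val f) (filter (x ≺?_) (allFin n)))

  q : (Fin n → Fin n) → Fin n → ℕ
  q f x = foldr _⊔_ 0 (map (val f) (filter (_≺? x) (allFin n)))

allFuns : (m k : ℕ) → List (Fin m → Fin k)
allFuns zero    k = (λ ()) ∷ []
allFuns (suc m) k =
  concatMap (λ i → map (λ g → λ { Fin.zero → i ; (Fin.suc j) → g j }) (allFuns m k))
            (allFin k)

ℕtoℚ : ℕ → ℚ
ℕtoℚ m = (+ m) ℚ./ 1

-- 1/L for L ≥ 1 (the number of linear extensions is always ≥ 1; the
-- zero case is never used)
inv : ℕ → ℚ
inv zero    = 0ℚ
inv (suc k) = (+ 1) ℚ./ suc k

sumℚ : List ℚ → ℚ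
sumℚ = foldr _+_ 0ℚ

module _ {n : ℕ} (_≼_ : Fin n → Fin n → Set)
         (isDPO : IsDecPartialOrder _≡_ _≼_) where

  linExts : List (Fin n → Fin n)
  linExts = filter (isLinExt? _≼_ isDPO) (allFuns n n)

  -- win(x) = E[r(x) - q(x)] for f uniform over linear extensions
  win : Fin n → ℚ
  win x = sumℚ (map (λ f → ℕtoℚ (r _≼_ isDPO f x) - ℕtoℚ (q _≼_ isDPO f x)) linExts)
          * inv (length linExts)

  IsAntichain : Subset n → Set
  IsAntichain A = ∀ x y → x ∈ A → y ∈ A → x ≼ y → x ≡ y

  sumWin : Subset n → ℚ
  sumWin A = sumℚ (map win (filter (_∈? A) (allFin n)))

module Submission where

-- Let N be the number of linear extensions and D x the set of those in which x sits directly above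
-- its highest predecessor (position q(x) + 1). Moving x down to that slot maps every linear extension
-- onto D x; the fibre over g consists of extensions differing only in the position of x, one of the
-- r(x) − q(x) − 1 free slots of g, and all of them have g's window r(x) − q(x). With m_g the fibre
-- sizes, N = Σ m_g and N·win(x) = Σ m_g (r − q)(g) ≥ Σ m_g (m_g + 1), so by Cauchy–Schwarz
-- (n + 1) N² ≤ n |D x| N win(x).
--
-- For an antichain A the sets D x (x ∈ A) embed jointly into the linear extensions: starting from
-- f ∈ D x, repeatedly move the highest predecessor of the element just moved down to its slot. In
-- the result x lies on the greedy chain (the first element, then always the earliest strict
-- successor of the previous one), which determines the elements moved, so the moves can be undone;
-- and a chain meets A at most once. Hence Σ_{x ∈ A} |D x| ≤ N, and Cauchy–Schwarz over A turns the
-- bounds above into Σ_{x ∈ A} win(x) ≥ (n + 1)|A|²/n.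

open import Data.Nat using (ℕ)
open import Data.Fin using (Fin)
open import Relation.Binary.PropositionalEquality using (_≡_)
open import Relation.Binary.Structures using (IsDecPartialOrder)

module Sums where
  open import Data.Nat using (ℕ; suc; _+_; _*_; _≤_; z≤n)
  open import Data.Nat.Properties
  open import Data.Nat.ListAction using (sum)
  open import Data.Nat.Solver using (module +-*-Solver)
  open import Data.List using (List; []; _∷_; map; length)
  open import Data.List.Relation.Unary.All as All using (All; []; _∷_)
  open import Data.Product using (_×_; _,_; proj₂)
  open import Data.Sum using (inj₁; inj₂)
  open import Relation.Binary.PropositionalEquality

  open +-*-Solver

  ∑ : ∀ {A : Set} → List A → (A → ℕ) → ℕ
  ∑ xs f = sum (map f xs)

  module _ {A : Set} where

    ∑-mono-≤ : ∀ {f g : A → ℕ} xs → All (λ x → f x ≤ g x) xs → ∑ xs f ≤ ∑ xs g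
    ∑-mono-≤ []       []           = z≤n
    ∑-mono-≤ (_ ∷ xs) (fx≤gx ∷ le) = +-mono-≤ fx≤gx (∑-mono-≤ xs le)

    ∑-const : ∀ c (xs : List A) → ∑ xs (λ _ → c) ≡ length xs * c
    ∑-const c []       = refl
    ∑-const c (_ ∷ xs) = cong (c +_) (∑-const c xs)

    ∑-1 : ∀ (xs : List A) → ∑ xs (λ _ → 1) ≡ length xs
    ∑-1 []       = refl
    ∑-1 (_ ∷ xs) = cong suc (∑-1 xs)

    ∑-+ : ∀ (f g : A → ℕ) xs → ∑ xs (λ x → f x + g x) ≡ ∑ xs f + ∑ xs g
    ∑-+ f g []       = refl
    ∑-+ f g (x ∷ xs) rewrite ∑-+ f g xs =
      solve 4 (λ a b c d → a :+ b :+ (c :+ d) := a :+ c :+ (b :+ d)) refl (f x) (g x) (∑ xs f) (∑ xs g)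

    ∑-*ˡ : ∀ c (f : A → ℕ) xs → ∑ xs (λ x → c * f x) ≡ c * ∑ xs f
    ∑-*ˡ c f []       = sym (*-zeroʳ c)
    ∑-*ˡ c f (x ∷ xs) rewrite ∑-*ˡ c f xs = sym (*-distribˡ-+ c (f x) (∑ xs f))

  private
    4m[m+d]≤[m+m+d]² : ∀ m d → 4 * (m * (m + d)) ≤ (m + (m + d)) * (m + (m + d))
    4m[m+d]≤[m+m+d]² m d = ≤-trans (m≤m+n _ (d * d)) (≤-reflexive
      (solve 2 (λ m d → con 4 :* (m :* (m :+ d)) :+ d :* d := (m :+ (m :+ d)) :* (m :+ (m :+ d))) refl m d))

  4mn≤[m+n]² : ∀ m n → 4 * (m * n) ≤ (m + n) * (m + n)
  4mn≤[m+n]² m n with ≤-total m n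
  ... | inj₁ m≤n with d , refl ← m≤n⇒∃[o]m+o≡n m≤n = 4m[m+d]≤[m+m+d]² m d
  ... | inj₂ n≤m with d , refl ← m≤n⇒∃[o]m+o≡n n≤m =
    subst₂ _≤_ (cong (4 *_) (*-comm n (n + d))) (cong (λ s → s * s) (+-comm n (n + d))) (4m[m+d]≤[m+m+d]² n d)

  -- The square of the left side is 4 (C c²) (C c′²) ≤ 4 (a b′) (a′ b), and 4 u v ≤ (u + v)².
  2Ccc′≤ab′+a′b : ∀ C c c′ a b a′ b′ → C * (c * c) ≤ a * b → C * (c′ * c′) ≤ a′ * b′ →
                  2 * (C * (c * c′)) ≤ a * b′ + a′ * b
  2Ccc′≤ab′+a′b C c c′ a b a′ b′ Cc²≤ab Cc′²≤a′b′ = ≮⇒≥ λ Y<X → <⇒≱ (*-mono-< Y<X Y<X) X²≤Y²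
    where
    open ≤-Reasoning
    X²≤Y² : 2 * (C * (c * c′)) * (2 * (C * (c * c′))) ≤ (a * b′ + a′ * b) * (a * b′ + a′ * b)
    X²≤Y² = begin
      2 * (C * (c * c′)) * (2 * (C * (c * c′)))
        ≡⟨ solve 3 (λ C c c′ → con 2 :* (C :* (c :* c′)) :* (con 2 :* (C :* (c :* c′)))
                             := con 4 :* ((C :* (c :* c)) :* (C :* (c′ :* c′)))) refl C c c′ ⟩
      4 * ((C * (c * c)) * (C * (c′ * c′)))
        ≤⟨ *-monoʳ-≤ 4 (*-mono-≤ Cc²≤ab Cc′²≤a′b′) ⟩
      4 * ((a * b) * (a′ * b′))
        ≡⟨ cong (4 *_) (solve 4 (λ a b a′ b′ → (a :* b) :* (a′ :* b′) := (a :* b′) :* (a′ :* b)) refl a b a′ b′) ⟩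
      4 * ((a * b′) * (a′ * b))
        ≤⟨ 4mn≤[m+n]² (a * b′) (a′ * b) ⟩
      (a * b′ + a′ * b) * (a * b′ + a′ * b) ∎

  module _ {A : Set} (C : ℕ) (a b c : A → ℕ) where

    private
      Bounded : A → Set
      Bounded x = C * (c x * c x) ≤ a x * b x

      cross-≤ : ∀ {x} xs → Bounded x → All Bounded xs →
                2 * (C * (c x * ∑ xs c)) ≤ a x * ∑ xs b + ∑ xs a * b x
      cross-≤ {x} [] _ [] = ≤-trans (≤-reflexive (solve 2 (λ C cx → con 2 :* (C :* (cx :* con 0)) := con 0) refl C (c x))) z≤n
      cross-≤ {x} (y ∷ xs) bx (by ∷ bxs) = begin
        2 * (C * (c x * (c y + ∑ xs c)))
          ≡⟨ solve 4 (λ C cx cy s → con 2 :* (C :* (cx :* (cy :+ s)))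
                                  := con 2 :* (C :* (cx :* cy)) :+ con 2 :* (C :* (cx :* s))) refl C (c x) (c y) (∑ xs c) ⟩
        2 * (C * (c x * c y)) + 2 * (C * (c x * ∑ xs c))
          ≤⟨ +-mono-≤ (2Ccc′≤ab′+a′b C (c x) (c y) (a x) (b x) (a y) (b y) bx by) (cross-≤ xs bx bxs) ⟩
        (a x * b y + a y * b x) + (a x * ∑ xs b + ∑ xs a * b x)
          ≡⟨ solve 6 (λ ax bx ay by sa sb → (ax :* by :+ ay :* bx) :+ (ax :* sb :+ sa :* bx)
                                          := ax :* (by :+ sb) :+ (ay :+ sa) :* bx) refl (a x) (b x) (a y) (b y) (∑ xs a) (∑ xs b) ⟩
        a x * (b y + ∑ xs b) + (a y + ∑ xs a) * b x ∎
        where open ≤-Reasoning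

    cauchy-schwarz : ∀ xs → All Bounded xs → C * (∑ xs c * ∑ xs c) ≤ ∑ xs a * ∑ xs b
    cauchy-schwarz []       []         = ≤-reflexive (*-zeroʳ C)
    cauchy-schwarz (x ∷ xs) (bx ∷ bxs) = begin
      C * ((c x + ∑ xs c) * (c x + ∑ xs c))
        ≡⟨ solve 3 (λ C cx s → C :* ((cx :+ s) :* (cx :+ s))
                             := C :* (cx :* cx) :+ con 2 :* (C :* (cx :* s)) :+ C :* (s :* s)) refl C (c x) (∑ xs c) ⟩
      C * (c x * c x) + 2 * (C * (c x * ∑ xs c)) + C * (∑ xs c * ∑ xs c)
        ≤⟨ +-mono-≤ (+-mono-≤ bx (cross-≤ xs bx bxs)) (cauchy-schwarz xs bxs) ⟩
      a x * b x + (a x * ∑ xs b + ∑ xs a * b x) + ∑ xs a * ∑ xs b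
        ≡⟨ solve 4 (λ ax bx sa sb → ax :* bx :+ (ax :* sb :+ sa :* bx) :+ sa :* sb := (ax :+ sa) :* (bx :+ sb))
                   refl (a x) (b x) (∑ xs a) (∑ xs b) ⟩
      (a x + ∑ xs a) * (b x + ∑ xs b) ∎
      where open ≤-Reasoning

  -- With M = ∑ m and d = length xs: M² ≤ d ∑ m² by Cauchy–Schwarz and M ≤ d n, so (n+1) M² ≤ d n ∑ (m² + m).
  square-sum-bound : ∀ {A : Set} n (m t : A → ℕ) xs → All (λ x → suc (m x) ≤ t x × m x ≤ n) xs →
                     suc n * (∑ xs m * ∑ xs m) ≤ length xs * n * ∑ xs (λ x → m x * t x)
  square-sum-bound n m t xs bounds = begin
    suc n * (M * M)              ≡⟨ +-comm (M * M) (n * (M * M)) ⟩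
    n * (M * M) + M * M          ≤⟨ +-mono-≤ (*-monoʳ-≤ n M²≤∑m²*d) (*-monoʳ-≤ M M≤dn) ⟩
    n * (∑ xs m² * d) + M * (d * n)
      ≡⟨ solve 4 (λ n d q M → n :* (q :* d) :+ M :* (d :* n) := d :* n :* (q :+ M)) refl n d (∑ xs m²) M ⟩
    d * n * (∑ xs m² + M)        ≡⟨ cong (d * n *_) (∑-+ m² m xs) ⟨
    d * n * ∑ xs (λ x → m² x + m x)
      ≤⟨ *-monoʳ-≤ (d * n) (∑-mono-≤ xs (All.map m²+m≤mt bounds)) ⟩
    d * n * ∑ xs (λ x → m x * t x) ∎
    where
    open ≤-Reasoning
    M = ∑ xs m
    d = length xs
    m² = λ x → m x * m x
    M²≤∑m²*d : M * M ≤ ∑ xs m² * d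
    M²≤∑m²*d = subst₂ _≤_ (*-identityˡ (M * M)) (cong (∑ xs m² *_) (∑-1 xs))
      (cauchy-schwarz 1 m² (λ _ → 1) m xs (All.map (λ {x} _ → ≤-reflexive (*-comm 1 (m² x))) bounds))
    M≤dn : M ≤ d * n
    M≤dn = ≤-trans (∑-mono-≤ xs (All.map proj₂ bounds)) (≤-reflexive (∑-const n xs))
    m²+m≤mt : ∀ {x} → suc (m x) ≤ t x × m x ≤ n → m² x + m x ≤ m x * t x
    m²+m≤mt {x} (1+m≤t , _) = ≤-trans (≤-reflexive (trans (+-comm (m² x) (m x)) (sym (*-suc (m x) (m x))))) (*-monoʳ-≤ (m x) 1+m≤t)

module Lists where
  open import Data.Bool using (if_then_else_)
  open import Level using (0ℓ)
  open import Data.Nat using (ℕ; suc; _+_; _⊔_; _≤_; _<_; z≤n; s≤s)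
  open import Data.Nat.Properties using (≤-reflexive; ≤-trans; +-identityʳ; m≤m⊔n; m≤n⊔m; ⊔-sel; module ≤-Reasoning)
  open import Data.Fin using (Fin)
  import Data.Fin.Properties as Fin
  open import Data.List using (List; []; _∷_; map; filter; foldr; length; concatMap)
  open import Data.List.Base using (allFin)
  open import Data.List.Membership.Propositional.Properties using (∈-allFin; ∈-filter⁺)
  import Data.List.Relation.Unary.Unique.Propositional.Properties as UniqueP
  open import Data.List.Properties using (filter-all; map-cong; length-++)
  open import Data.Nat.ListAction using (sum)
  open import Data.List.Relation.Unary.All as All using (All; []; _∷_)
  import Data.List.Relation.Unary.All.Properties as All
  open import Data.List.Relation.Unary.Any using (here; there)
  open import Data.List.Relation.Unary.AllPairs using (AllPairs; []; _∷_)
  open import Data.Product using (_×_; _,_; ∃)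
  open import Data.Sum using (_⊎_; inj₁; inj₂)
  open import Function using (_∘_)
  open import Relation.Binary.Bundles using (DecSetoid)
  open import Relation.Binary.PropositionalEquality using (_≡_; refl; cong; cong₂; subst; module ≡-Reasoning)
    renaming (sym to ≡-sym; trans to ≡-trans)
  open import Relation.Nullary using (¬_; yes; no; ¬?; does; contradiction)
  open import Relation.Unary using (Decidable)
  open Sums using (∑; ∑-+)

  module Counting (S : DecSetoid 0ℓ 0ℓ) where

    open DecSetoid S using (setoid; _≈_; sym; trans) renaming (Carrier to B; _≟_ to _≈?_)
    open import Data.List.Membership.Setoid setoid using (_∈_)
    open import Data.List.Relation.Unary.Unique.Setoid setoid using (Unique)
    import Data.List.Relation.Unary.Unique.Setoid.Properties as Unique

    private
      length≤1+length-filter : ∀ y {xs} → Unique xs → length xs ≤ suc (length (filter (¬? ∘ (_≈? y)) xs))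
      length≤1+length-filter y {[]}     _           = z≤n
      length≤1+length-filter y {x ∷ xs} (x≉xs ∷ xs!) with x ≈? y
      ... | yes x≈y = ≤-reflexive (cong (suc ∘ length) (≡-sym (filter-all (¬? ∘ (_≈? y)) xs≉y)))
        where xs≉y = All.map (λ x≉z z≈y → x≉z (trans x≈y (sym z≈y))) x≉xs
      ... | no  _   = s≤s (length≤1+length-filter y xs!)

    unique⊆⇒length≤ : ∀ {xs} ys → Unique xs → All (_∈ ys) xs → length xs ≤ length ys
    unique⊆⇒length≤ {[]}    _        _   _          = z≤n
    unique⊆⇒length≤ {_ ∷ _} []       _   (() ∷ _)
    unique⊆⇒length≤ {xs}    (y ∷ ys) xs! xs⊆y∷ys = begin
      length xs                                    ≤⟨ length≤1+length-filter y xs! ⟩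
      suc (length (filter (¬? ∘ (_≈? y)) xs))      ≤⟨ s≤s (unique⊆⇒length≤ ys (Unique.filter⁺ setoid (¬? ∘ (_≈? y)) xs!) rest⊆ys) ⟩
      suc (length ys)                              ∎
      where
      open ≤-Reasoning
      rest⊆ys : All (_∈ ys) (filter (¬? ∘ (_≈? y)) xs)
      rest⊆ys = All.map (λ { (here z≈y , z≉y) → contradiction z≈y z≉y ; (there z∈ys , _) → z∈ys })
                        (All.zip (All.filter⁺ (¬? ∘ (_≈? y)) xs⊆y∷ys , All.all-filter (¬? ∘ (_≈? y)) xs))

    module _ {A : Set} (κ : A → B) where

      fibre : B → List A → List A
      fibre g = filter (λ x → κ x ≈? g)

      module _ (h : A → ℕ) where
        private
          δ : A → B → ℕ
          δ x g = if does (κ x ≈? g) then h x else 0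

          ∑δ≡0 : ∀ {x} D → All (λ g → ¬ κ x ≈ g) D → ∑ D (δ x) ≡ 0
          ∑δ≡0     []       []           = refl
          ∑δ≡0 {x} (g ∷ D) (κx≉g ∷ κx≉D) with κ x ≈? g
          ... | yes κx≈g = contradiction κx≈g κx≉g
          ... | no  _    = ∑δ≡0 D κx≉D

          ∑δ≡h : ∀ {x D} → Unique D → κ x ∈ D → ∑ D (δ x) ≡ h x
          ∑δ≡h {x} {g ∷ D} (g≉D ∷ D!) κx∈g∷D with κ x ≈? g | κx∈g∷D
          ... | yes κx≈g | _           = ≡-trans (cong (h x +_) (∑δ≡0 D κx≉D)) (+-identityʳ (h x))
            where κx≉D = All.map (λ g≉g′ κx≈g′ → g≉g′ (trans (sym κx≈g) κx≈g′)) g≉D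
          ... | no  κx≉g | here κx≈g  = contradiction κx≈g κx≉g
          ... | no  _    | there κx∈D = ∑δ≡h D! κx∈D

          fibre-∷ : ∀ x xs g → ∑ (fibre g (x ∷ xs)) h ≡ δ x g + ∑ (fibre g xs) h
          fibre-∷ x xs g with κ x ≈? g
          ... | yes _ = refl
          ... | no  _ = refl

        ∑-fibres : ∀ {D} → Unique D → ∀ xs → All (λ x → κ x ∈ D) xs →
                   ∑ xs h ≡ ∑ D (λ g → ∑ (fibre g xs) h)
        ∑-fibres {D} D! []       []              = ≡-sym (∑-zero D)
          where
          ∑-zero : ∀ D → ∑ D (λ g → ∑ (fibre g []) h) ≡ 0
          ∑-zero []      = refl
          ∑-zero (_ ∷ D) = ∑-zero D
        ∑-fibres {D} D! (x ∷ xs) (κx∈D ∷ κxs∈D) = begin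
          h x + ∑ xs h                                            ≡⟨ cong₂ _+_ (≡-sym (∑δ≡h D! κx∈D)) (∑-fibres D! xs κxs∈D) ⟩
          ∑ D (δ x) + ∑ D (λ g → ∑ (fibre g xs) h)                ≡⟨ ≡-sym (∑-+ (δ x) (λ g → ∑ (fibre g xs) h) D) ⟩
          ∑ D (λ g → δ x g + ∑ (fibre g xs) h)                    ≡⟨ cong sum (map-cong (λ g → ≡-sym (fibre-∷ x xs g)) D) ⟩
          ∑ D (λ g → ∑ (fibre g (x ∷ xs)) h)                      ∎
          where open ≡-Reasoning

  module _ {A : Set} {P : A → Set} {R S : A → A → Set} (R⇒S : ∀ {a b} → P a → P b → R a b → S a b) where

    allPairs-map-under-All : ∀ {xs} → All P xs → AllPairs R xs → AllPairs S xs
    allPairs-map-under-All []         []           = []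
    allPairs-map-under-All (pa ∷ pas) (Ra∷ ∷ Rxs) =
      All.zipWith (λ { (pb , Rab) → R⇒S pa pb Rab }) (pas , Ra∷) ∷ allPairs-map-under-All pas Rxs

  length-concatMap : ∀ {A B : Set} (f : A → List B) xs → length (concatMap f xs) ≡ ∑ xs (length ∘ f)
  length-concatMap f []       = refl
  length-concatMap f (x ∷ xs) = ≡-trans (length-++ (f x)) (cong (length (f x) +_) (length-concatMap f xs))

  module _ {A : Set} (g : A → ℕ) where
    open import Data.List.Membership.Propositional using (_∈_)

    foldr-⊔-map-≥ : ∀ {y ys} → y ∈ ys → g y ≤ foldr _⊔_ 0 (map g ys)
    foldr-⊔-map-≥ {ys = z ∷ zs} (here refl) = m≤m⊔n (g z) _
    foldr-⊔-map-≥ {ys = z ∷ zs} (there y∈zs) = ≤-trans (foldr-⊔-map-≥ y∈zs) (m≤n⊔m (g z) _)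

    foldr-⊔-map-attained : ∀ ys → foldr _⊔_ 0 (map g ys) ≡ 0 ⊎ ∃ λ y → y ∈ ys × foldr _⊔_ 0 (map g ys) ≡ g y
    foldr-⊔-map-attained []       = inj₁ refl
    foldr-⊔-map-attained (z ∷ zs) with ⊔-sel (g z) (foldr _⊔_ 0 (map g zs)) | foldr-⊔-map-attained zs
    ... | inj₁ max≡gz | _                    = inj₂ (z , here refl , max≡gz)
    ... | inj₂ max≡mx | inj₁ mx≡0            = inj₁ (≡-trans max≡mx mx≡0)
    ... | inj₂ max≡mx | inj₂ (y , y∈zs , mx≡gy) = inj₂ (y , there y∈zs , ≡-trans max≡mx mx≡gy)

  module _ {n} {P Q : Fin n → Set} (P? : Decidable P) (Q? : Decidable Q) where
    open Counting (Fin.≡-decSetoid n) using (unique⊆⇒length≤)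

    count-< : ∀ {x} → ¬ P x → Q x → (∀ {z} → P z → Q z) → length (filter P? (allFin n)) < length (filter Q? (allFin n))
    count-< {x} ¬Px Qx P⇒Q = unique⊆⇒length≤ (filter Q? (allFin n))
      (All.map (λ Pz x≡z → ¬Px (subst P (≡-sym x≡z) Pz)) (All.all-filter P? (allFin n)) ∷ UniqueP.filter⁺ P? (UniqueP.allFin⁺ n))
      (∈-filter⁺ Q? (∈-allFin x) Qx ∷ All.map (λ {z} Pz → ∈-filter⁺ Q? (∈-allFin z) (P⇒Q Pz)) (All.all-filter P? (allFin n)))

module Positions where
  open import Data.Nat as ℕ using (ℕ; zero; suc; s≤s)
  open import Data.Nat.Properties using (<⇒≢; <⇒≤; n≮n; 1+n≰n; ≤∧≢⇒<)
  open import Data.Fin using (Fin; zero; suc; toℕ; _<_; punchIn; punchOut; _≟_)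
  open import Data.Fin.Properties
    using (toℕ-injective; any?; injective⇒≤; punchOut-injective; punchIn-injective; punchInᵢ≢i;
           punchIn-mono-≤; punchOut-mono-≤; punchIn-punchOut; suc-injective)
  open import Data.Product using (∃; _,_)
  open import Function using (_∘_)
  open import Relation.Binary.PropositionalEquality using (_≡_; _≢_; refl; sym; trans; cong; subst)
  open import Relation.Nullary using (yes; no; contradiction)

  injective⇒surjective : ∀ {n} {f : Fin n → Fin n} → (∀ i j → f i ≡ f j → i ≡ j) → ∀ t → ∃ λ i → f i ≡ t
  injective⇒surjective {suc m} {f} f-inj t with any? (λ i → f i ≟ t)
  ... | yes hit = hit
  ... | no  ¬hit = contradiction (injective⇒≤ punchOut∘f-injective) 1+n≰n
    where
    t≢f : ∀ i → t ≢ f i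
    t≢f i t≡fi = ¬hit (i , sym t≡fi)
    punchOut∘f-injective : ∀ {i j} → punchOut (t≢f i) ≡ punchOut (t≢f j) → i ≡ j
    punchOut∘f-injective {i} {j} eq = f-inj i j (punchOut-injective (t≢f i) (t≢f j) eq)

  toℕ-punchIn-< : ∀ {n} (i : Fin (suc n)) j → toℕ j ℕ.< toℕ i → toℕ (punchIn i j) ≡ toℕ j
  toℕ-punchIn-< (suc i) zero    _         = refl
  toℕ-punchIn-< (suc i) (suc j) (s≤s j<i) = cong suc (toℕ-punchIn-< i j j<i)

  toℕ-punchIn-≥ : ∀ {n} (i : Fin (suc n)) j → toℕ i ℕ.≤ toℕ j → toℕ (punchIn i j) ≡ suc (toℕ j)
  toℕ-punchIn-≥ zero    j       _         = refl
  toℕ-punchIn-≥ (suc i) (suc j) (s≤s i≤j) = cong suc (toℕ-punchIn-≥ i j i≤j)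

  toℕ-punchOut-< : ∀ {n} {i j : Fin (suc n)} (i≢j : i ≢ j) → toℕ j ℕ.< toℕ i → toℕ (punchOut i≢j) ≡ toℕ j
  toℕ-punchOut-< {suc _} {suc i} {zero}  _   _         = refl
  toℕ-punchOut-< {suc _} {suc i} {suc j} i≢j (s≤s j<i) = cong suc (toℕ-punchOut-< (i≢j ∘ cong suc) j<i)

  suc-toℕ-punchOut-> : ∀ {n} {i j : Fin (suc n)} (i≢j : i ≢ j) → toℕ i ℕ.< toℕ j → suc (toℕ (punchOut i≢j)) ≡ toℕ j
  suc-toℕ-punchOut-> {_}     {zero}  {suc j} _   _         = refl
  suc-toℕ-punchOut-> {suc _} {suc i} {suc j} i≢j (s≤s i<j) = cong suc (suc-toℕ-punchOut-> (i≢j ∘ cong suc) i<j)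

  -- moveTo a b is the permutation taking position b to position a and shifting everything in between by one towards b.
  moveTo : ∀ {n} → Fin n → Fin n → Fin n → Fin n
  moveTo {suc _} a b i with b ≟ i
  ... | yes _   = a
  ... | no  b≢i = punchIn a (punchOut b≢i)

  moveTo-injective : ∀ {n} (a b : Fin n) {i j} → moveTo a b i ≡ moveTo a b j → i ≡ j
  moveTo-injective {suc _} a b {i} {j} eq with b ≟ i | b ≟ j
  ... | yes b≡i | yes b≡j = trans (sym b≡i) b≡j
  ... | yes _   | no  _   = contradiction (sym eq) (punchInᵢ≢i a _)
  ... | no  _   | yes _   = contradiction eq (punchInᵢ≢i a _)
  ... | no  b≢i | no  b≢j = punchOut-injective b≢i b≢j (punchIn-injective a _ _ eq)

  moveTo-source : ∀ {n} (a b : Fin n) → moveTo a b b ≡ a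
  moveTo-source {suc _} a b with b ≟ b
  ... | yes _   = refl
  ... | no  b≢b = contradiction refl b≢b

  moveTo-fixes-< : ∀ {n} (a b : Fin n) {i} → i < a → i < b → moveTo a b i ≡ i
  moveTo-fixes-< {suc _} a b {i} i<a i<b with b ≟ i
  ... | yes refl = contradiction i<b (n≮n _)
  ... | no  b≢i  = toℕ-injective (trans (toℕ-punchIn-< a _ (subst (ℕ._< toℕ a) (sym po≡i) i<a)) po≡i)
    where po≡i = toℕ-punchOut-< b≢i i<b

  moveTo-fixes-> : ∀ {n} (a b : Fin n) {i} → a < i → b < i → moveTo a b i ≡ i
  moveTo-fixes-> {suc _} a b {i} a<i b<i with b ≟ i
  ... | yes refl = contradiction b<i (n≮n _)
  ... | no  b≢i  = toℕ-injective (trans (toℕ-punchIn-≥ a _ a≤po) 1+po≡i)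
    where
    1+po≡i = suc-toℕ-punchOut-> b≢i b<i
    a≤po = ℕ.s≤s⁻¹ (subst (toℕ a ℕ.<_) (sym 1+po≡i) a<i)

  moveTo-mono-< : ∀ {n} (a b : Fin n) {i j} → b ≢ i → b ≢ j → i < j → moveTo a b i < moveTo a b j
  moveTo-mono-< {suc _} a b {i} {j} b≢i b≢j i<j with b ≟ i | b ≟ j
  ... | yes b≡i | _       = contradiction b≡i b≢i
  ... | no  _   | yes b≡j = contradiction b≡j b≢j
  ... | no  b≢i | no  b≢j = ≤∧≢⇒< (punchIn-mono-≤ a _ _ (punchOut-mono-≤ b≢i b≢j (<⇒≤ i<j)))
    (λ eq → <⇒≢ i<j (cong toℕ (punchOut-injective b≢i b≢j (punchIn-injective a _ _ (toℕ-injective eq)))))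

  moveTo-id : ∀ {n} (b i : Fin n) → moveTo b b i ≡ i
  moveTo-id {suc _} b i with b ≟ i
  ... | yes b≡i = b≡i
  ... | no  b≢i = punchIn-punchOut b≢i

module Enumeration where
  open import Data.Bool using (true; false)
  open import Data.Nat using (ℕ; zero; suc)
  open import Data.Fin using (Fin; zero; suc; _≟_)
  open import Data.Fin.Properties using (all?)
  open import Data.Fin.Subset using (Subset; ∣_∣; inside; outside)
  open import Data.Fin.Subset.Properties using (_∈?_)
  open import Data.List using ([]; _∷_; map; filter; length; tabulate)
  open import Data.List.Base using (allFin)
  open import Data.List.Membership.Propositional.Properties using (∈-allFin)
  open import Data.List.Relation.Unary.Any as Any using (Any; here)
  import Data.List.Relation.Unary.Any.Properties as Any
  open import Data.List.Relation.Unary.All as All using (All; [])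
  import Data.List.Relation.Unary.All.Properties as All
  open import Data.List.Relation.Unary.AllPairs as AllPairs using (AllPairs; []; _∷_)
  import Data.List.Relation.Unary.AllPairs.Properties as AllPairs
  open import Data.Vec using ([]; _∷_)
  open import Function using (_∘_)
  open import Level using (0ℓ)
  open import Relation.Binary.Bundles using (Setoid; DecSetoid)
  open import Relation.Binary.PropositionalEquality
  open import Relation.Nullary using (¬_; does)
  open import Defs using (allFuns)

  ≗-decSetoid : ℕ → ℕ → DecSetoid 0ℓ 0ℓ
  ≗-decSetoid m k = record
    { Carrier          = Fin m → Fin k
    ; _≈_              = _≗_
    ; isDecEquivalence = record
      { isEquivalence = Setoid.isEquivalence (Fin m →-setoid Fin k)
      ; _≟_           = λ f g → all? (λ i → f i ≟ g i)
      }
    }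

  allFuns-complete : ∀ m {k} (f : Fin m → Fin k) → Any (f ≗_) (allFuns m k)
  allFuns-complete zero    f = here (λ ())
  allFuns-complete (suc m) f =
    Any.concat⁺ (Any.map⁺ (Any.map (λ f0≡i → Any.map⁺ (Any.map (λ f∘suc≗g → λ { zero → f0≡i ; (suc j) → f∘suc≗g j })
                                                              (allFuns-complete m (f ∘ suc))))
                                   (∈-allFin (f zero))))

  allFuns-unique : ∀ m {k} → AllPairs (λ f g → ¬ f ≗ g) (allFuns m k)
  allFuns-unique zero        = [] ∷ []
  allFuns-unique (suc m) {k} =
    AllPairs.concat⁺
      (All.map⁺ (All.universal (λ _ → AllPairs.map⁺ (AllPairs.map (λ f≉g e → f≉g (e ∘ suc)) (allFuns-unique m))) (allFin k)))
      (AllPairs.map⁺ (AllPairs.tabulate⁺ λ i≢j → All.map⁺ (All.universal (λ _ → All.map⁺ (All.universal (λ _ e → i≢j (e zero)) _)) _)))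

  private
    count-suc : ∀ {n k} (f : Fin k → Fin n) b (p : Subset n) →
                length (filter (_∈? (b ∷ p)) (tabulate (suc ∘ f))) ≡ length (filter (_∈? p) (tabulate f))
    count-suc {k = zero}  f b p = refl
    count-suc {k = suc k} f b p with does (f zero ∈? p)
    ... | true  = cong suc (count-suc (f ∘ suc) b p)
    ... | false = count-suc (f ∘ suc) b p

  ∣p∣≡count-∈ : ∀ {n} (p : Subset n) → ∣ p ∣ ≡ length (filter (_∈? p) (allFin n))
  ∣p∣≡count-∈ []            = refl
  ∣p∣≡count-∈ (inside ∷ p)  = cong suc (trans (∣p∣≡count-∈ p) (sym (count-suc (λ i → i) inside p)))
  ∣p∣≡count-∈ (outside ∷ p) = trans (∣p∣≡count-∈ p) (sym (count-suc (λ i → i) outside p))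

module Rationals where
  open import Data.Nat as ℕ using (ℕ; suc; _≤_; _∸_; NonZero)
  import Data.Nat.Properties as ℕP
  open import Data.Integer as ℤ using (+_; +≤+)
  import Data.Integer.Properties as ℤP
  open import Data.List using ([]; _∷_; map)
  open import Data.Rational as ℚ using (ℚ; 0ℚ; _+_; _-_; _*_; -_; toℚᵘ)
  import Data.Rational.Properties as ℚP
  open import Data.Rational.Unnormalised as ℚᵘ using (ℚᵘ; mkℚᵘ; *≡*; *≤*)
  import Data.Rational.Unnormalised.Properties as ℚᵘP
  open import Function using (_∘_)
  open import Relation.Binary.PropositionalEquality
  open import Defs using (ℕtoℚ; inv; sumℚ)
  open Sums using (∑)

  private
    ι : ℕ → ℚᵘ
    ι a = mkℚᵘ (+ a) 0

    toℚᵘ-ℕtoℚ : ∀ a → toℚᵘ (ℕtoℚ a) ℚᵘ.≃ ι a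
    toℚᵘ-ℕtoℚ a = ℚP.toℚᵘ-fromℚᵘ (ι a)

    ι-+ : ∀ a b → ι (a ℕ.+ b) ℚᵘ.≃ ι a ℚᵘ.+ ι b
    ι-+ a b = *≡* (cong (ℤ._* + 1) (trans (ℤP.pos-+ a b) (sym (cong₂ ℤ._+_ (ℤP.*-identityʳ (+ a)) (ℤP.*-identityʳ (+ b))))))

  ℕtoℚ-+ : ∀ a b → ℕtoℚ (a ℕ.+ b) ≡ ℕtoℚ a + ℕtoℚ b
  ℕtoℚ-+ a b = ℚP.toℚᵘ-injective (begin
    toℚᵘ (ℕtoℚ (a ℕ.+ b))                 ≈⟨ toℚᵘ-ℕtoℚ (a ℕ.+ b) ⟩
    ι (a ℕ.+ b)                           ≈⟨ ι-+ a b ⟩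
    ι a ℚᵘ.+ ι b                          ≈⟨ ℚᵘP.+-cong (toℚᵘ-ℕtoℚ a) (toℚᵘ-ℕtoℚ b) ⟨
    toℚᵘ (ℕtoℚ a) ℚᵘ.+ toℚᵘ (ℕtoℚ b)      ≈⟨ ℚP.toℚᵘ-homo-+ (ℕtoℚ a) (ℕtoℚ b) ⟨
    toℚᵘ (ℕtoℚ a + ℕtoℚ b)                ∎)
    where open ℚᵘP.≃-Reasoning

  ℕtoℚ-∸ : ∀ a b → b ≤ a → ℕtoℚ (a ∸ b) ≡ ℕtoℚ a - ℕtoℚ b
  ℕtoℚ-∸ a b b≤a = begin
    ℕtoℚ (a ∸ b)                          ≡⟨ ℚP.+-identityʳ (ℕtoℚ (a ∸ b)) ⟨
    ℕtoℚ (a ∸ b) + 0ℚ                     ≡⟨ cong (λ t → ℕtoℚ (a ∸ b) + t) (ℚP.+-inverseʳ (ℕtoℚ b)) ⟨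
    ℕtoℚ (a ∸ b) + (ℕtoℚ b - ℕtoℚ b)      ≡⟨ ℚP.+-assoc (ℕtoℚ (a ∸ b)) (ℕtoℚ b) (- ℕtoℚ b) ⟨
    (ℕtoℚ (a ∸ b) + ℕtoℚ b) - ℕtoℚ b      ≡⟨ cong (_- ℕtoℚ b) (ℕtoℚ-+ (a ∸ b) b) ⟨
    ℕtoℚ (a ∸ b ℕ.+ b) - ℕtoℚ b           ≡⟨ cong (λ c → ℕtoℚ c - ℕtoℚ b) (ℕP.m∸n+n≡m b≤a) ⟩
    ℕtoℚ a - ℕtoℚ b                       ∎
    where open ≡-Reasoning

  sumℚ-ℕtoℚ : ∀ {A : Set} (g : A → ℕ) xs → sumℚ (map (ℕtoℚ ∘ g) xs) ≡ ℕtoℚ (∑ xs g)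
  sumℚ-ℕtoℚ g []       = refl
  sumℚ-ℕtoℚ g (x ∷ xs) = trans (cong (λ t → ℕtoℚ (g x) + t) (sumℚ-ℕtoℚ g xs)) (sym (ℕtoℚ-+ (g x) (∑ xs g)))

  sumℚ-*ʳ : ∀ {A : Set} (h : A → ℚ) c xs → sumℚ (map (λ x → h x * c) xs) ≡ sumℚ (map h xs) * c
  sumℚ-*ʳ h c []       = sym (ℚP.*-zeroˡ c)
  sumℚ-*ʳ h c (x ∷ xs) = trans (cong (λ t → h x * c + t) (sumℚ-*ʳ h c xs)) (sym (ℚP.*-distribʳ-+ c (h x) (sumℚ (map h xs))))

  +/≤ℕtoℚ*inv : ∀ X n M N .{{_ : NonZero n}} .{{_ : NonZero N}} → X ℕ.* N ≤ M ℕ.* n → (+ X) ℚ./ n ℚ.≤ ℕtoℚ M * inv N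
  +/≤ℕtoℚ*inv X (suc n) M (suc N) X[1+N]≤Mn = ℚP.toℚᵘ-cancel-≤ (begin
    toℚᵘ ((+ X) ℚ./ suc n)                ≃⟨ ℚP.toℚᵘ-fromℚᵘ (mkℚᵘ (+ X) n) ⟩
    mkℚᵘ (+ X) n                          ≤⟨ *≤* (subst₂ ℤ._≤_ (ℤP.pos-* X (suc N)) (ℤP.pos-* M (suc n)) (+≤+ X[1+N]≤Mn)) ⟩
    mkℚᵘ (+ M) N                          ≃⟨ *≡* (cong₂ ℤ._*_ (ℤP.*-identityʳ (+ M)) (cong +_ (sym (ℕP.+-identityʳ (suc N))))) ⟨
    ι M ℚᵘ.* mkℚᵘ (+ 1) N                 ≃⟨ ℚᵘP.*-cong (toℚᵘ-ℕtoℚ M) (ℚP.toℚᵘ-fromℚᵘ (mkℚᵘ (+ 1) N)) ⟨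
    toℚᵘ (ℕtoℚ M) ℚᵘ.* toℚᵘ (inv (suc N)) ≃⟨ ℚP.toℚᵘ-homo-* (ℕtoℚ M) (inv (suc N)) ⟨
    toℚᵘ (ℕtoℚ M * inv (suc N))           ∎)
    where open ℚᵘP.≤-Reasoning

module LinearExtensions {n : ℕ} (_≼_ : Fin n → Fin n → Set) (isDPO : IsDecPartialOrder _≡_ _≼_) where
  open import Data.Nat as ℕ using (ℕ; zero; suc; _⊓_; _⊔_; _≤_; _<_; z≤n; s≤s)
  open import Data.Nat.Properties hiding (_≟_)
  open import Data.Fin as Fin using (Fin; toℕ; fromℕ<; _≟_)
  import Data.Fin.Properties as Fin
  open import Data.List using (map; filter; foldr; length)
  open import Data.List.Base using (allFin)
  open import Data.List.Properties using (map-cong-local; foldr-preservesᵇ; filter-all; length-tabulate)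
  open import Data.List.Membership.Propositional using (_∈_)
  open import Data.List.Membership.Propositional.Properties using (∈-allFin; ∈-filter⁺; ∈-filter⁻)
  open import Data.List.Relation.Unary.All as All using (All)
  import Data.List.Relation.Unary.All.Properties as All
  open import Data.Product using (_×_; _,_; ∃; proj₁; proj₂)
  open import Data.Sum using (_⊎_; inj₁; inj₂)
  open import Function using (_∘_; id)
  open import Relation.Binary.PropositionalEquality
  open import Relation.Binary.Bundles using (StrictTotalOrder)
  open import Relation.Binary.Definitions using (tri<; tri≈; tri>)
  open import Data.Product.Relation.Binary.Lex.Strict using (×-strictTotalOrder)
  open import Data.Unit using (tt)
  open import Relation.Nullary using (Dec; yes; no; contradiction)
  open import Relation.Nullary.Decidable using (_×-dec_)
  import Defs
  open Positions
  open Lists using (foldr-⊔-map-≥; foldr-⊔-map-attained; count-<)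

  open IsDecPartialOrder isDPO using ()
    renaming (_≤?_ to _≼?_; refl to ≼-refl; reflexive to ≼-reflexive; trans to ≼-trans; antisym to ≼-antisym)

  Labelling : Set
  Labelling = Fin n → Fin n

  _≺_ : Fin n → Fin n → Set
  _≺_ = Defs._≺_ _≼_ isDPO

  _≺?_ : ∀ x y → Dec (x ≺ y)
  _≺?_ = Defs._≺?_ _≼_ isDPO

  val : Labelling → Fin n → ℕ
  val = Defs.val _≼_ isDPO

  q r : Labelling → Fin n → ℕ
  q = Defs.q _≼_ isDPO
  r = Defs.r _≼_ isDPO

  IsLinExt : Labelling → Set
  IsLinExt = Defs.IsLinExt _≼_ isDPO

  ≼⇒≡⊎≺ : ∀ {x y} → x ≼ y → x ≡ y ⊎ x ≺ y
  ≼⇒≡⊎≺ {x} {y} x≼y with x ≟ y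
  ... | yes x≡y = inj₁ x≡y
  ... | no  x≢y = inj₂ (x≼y , x≢y)

  private
    ∈-below : ∀ {x y} → y ≺ x → y ∈ filter (_≺? x) (allFin n)
    ∈-below {x} {y} = ∈-filter⁺ (_≺? x) (∈-allFin y)

  q-≥ : ∀ f {x y} → y ≺ x → val f y ≤ q f x
  q-≥ f y≺x = foldr-⊔-map-≥ (val f) (∈-below y≺x)

  q-attained : ∀ f x → q f x ≡ 0 ⊎ ∃ λ y → y ≺ x × q f x ≡ val f y
  q-attained f x with foldr-⊔-map-attained (val f) (filter (_≺? x) (allFin n))
  ... | inj₁ q≡0              = inj₁ q≡0
  ... | inj₂ (y , y∈ , q≡fy)  = inj₂ (y , proj₂ (∈-filter⁻ (_≺? x) {xs = allFin n} y∈) , q≡fy)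

  q-cong : ∀ {f g} x → (∀ {y} → y ≺ x → val f y ≡ val g y) → q f x ≡ q g x
  q-cong x f≡g = cong (foldr _⊔_ 0) (map-cong-local (All.map f≡g (All.all-filter (_≺? x) (allFin n))))

  r-cong : ∀ {f g} x → (∀ {y} → x ≺ y → val f y ≡ val g y) → r f x ≡ r g x
  r-cong x f≡g = cong (foldr _⊓_ (suc n)) (map-cong-local (All.map f≡g (All.all-filter (x ≺?_) (allFin n))))

  q-≗ : ∀ {f g} x → f ≗ g → q f x ≡ q g x
  q-≗ x f≗g = q-cong x (λ {y} _ → cong (suc ∘ toℕ) (f≗g y))

  r-≗ : ∀ {f g} x → f ≗ g → r f x ≡ r g x
  r-≗ x f≗g = r-cong x (λ {y} _ → cong (suc ∘ toℕ) (f≗g y))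

  r≤1+n : ∀ f x → r f x ≤ suc n
  r≤1+n f x = foldr-preservesᵇ {P = _≤ suc n} (λ {a} {b} a≤ _ → ≤-trans (m⊓n≤m a b) a≤) ≤-refl
                (All.map⁺ (All.universal (λ y → s≤s (<⇒≤ (Fin.toℕ<n (f y)))) (filter (x ≺?_) (allFin n))))

  linExt-resp-≗ : ∀ {f g} → f ≗ g → IsLinExt f → IsLinExt g
  linExt-resp-≗ {f} {g} f≗g (f-inj , f-surj , f-mono) =
    (λ x y gx≡gy → f-inj x y (trans (f≗g x) (trans gx≡gy (sym (f≗g y))))) ,
    (λ t → let (x , fx≡t) = f-surj t in x , trans (sym (f≗g x)) fx≡t) ,
    (λ x y x≼y → subst₂ _≤_ (cong (suc ∘ toℕ) (f≗g x)) (cong (suc ∘ toℕ) (f≗g y)) (f-mono x y x≼y))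

  linExt-injective : ∀ {f} → IsLinExt f → ∀ {x y} → f x ≡ f y → x ≡ y
  linExt-injective (f-inj , _ , _) = f-inj _ _

  linExt-mono-< : ∀ {f} → IsLinExt f → ∀ {x y} → x ≺ y → f x Fin.< f y
  linExt-mono-< f-ext@(_ , _ , f-mono) (x≼y , x≢y) = ≤∧≢⇒< (ℕ.s≤s⁻¹ (f-mono _ _ x≼y)) (x≢y ∘ linExt-injective f-ext ∘ Fin.toℕ-injective)

  q≤toℕ : ∀ {f} → IsLinExt f → ∀ x → q f x ≤ toℕ (f x)
  q≤toℕ {f} f-ext x with q-attained f x
  ... | inj₁ q≡0               = ≤-trans (≤-reflexive q≡0) z≤n
  ... | inj₂ (y , y≺x , q≡fy)  = ≤-trans (≤-reflexive q≡fy) (linExt-mono-< f-ext y≺x)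

  val<r : ∀ {f} → IsLinExt f → ∀ x → val f x < r f x
  val<r {f} f-ext x = foldr-preservesᵇ {P = val f x <_} ⊓-glb (s≤s (Fin.toℕ<n (f x)))
                        (All.map⁺ (All.map (s≤s ∘ linExt-mono-< f-ext) (All.all-filter (x ≺?_) (allFin n))))

  -- drop x f moves x down to the lowest position its predecessors allow, just above the highest of them.
  -- The ⊓ in slot only matters when f is not a linear extension.
  slot : Labelling → Fin n → Fin n
  slot f x = fromℕ< (≤-<-trans (m⊓n≤n (q f x) (toℕ (f x))) (Fin.toℕ<n (f x)))

  drop : Fin n → Labelling → Labelling
  drop x f = moveTo (slot f x) (f x) ∘ f

  drop-id : ∀ {f} x → toℕ (f x) ≡ q f x → drop x f ≗ f
  drop-id {f} x fx≡q y = trans (cong (λ a → moveTo a (f x) (f y)) slot≡fx) (moveTo-id (f x) (f y))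
    where
    slot≡fx : slot f x ≡ f x
    slot≡fx = Fin.toℕ-injective (trans (Fin.toℕ-fromℕ< _) (trans (cong (_⊓ toℕ (f x)) (sym fx≡q)) (⊓-idem (toℕ (f x)))))

  drop-cancel : ∀ {f g} x → drop x f ≗ drop x g → f x ≡ g x → q f x ≡ q g x → f ≗ g
  drop-cancel {f} {g} x df≗dg fx≡gx qf≡qg y =
    moveTo-injective (slot g x) (g x) (trans (sym (cong₂ (λ a b → moveTo a b (f y)) slot≡ fx≡gx)) (df≗dg y))
    where
    slot≡ : slot f x ≡ slot g x
    slot≡ = Fin.fromℕ<-cong _ _ (cong₂ _⊓_ qf≡qg (cong toℕ fx≡gx)) _ _

  module _ {f} (f-ext : IsLinExt f) (x : Fin n) where

    private
      toℕ-slot : toℕ (slot f x) ≡ q f x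
      toℕ-slot = trans (Fin.toℕ-fromℕ< _) (m≤n⇒m⊓n≡m (q≤toℕ f-ext x))

    drop-fixes-< : ∀ {y} → toℕ (f y) < q f x → drop x f y ≡ f y
    drop-fixes-< fy<q = moveTo-fixes-< (slot f x) (f x) (subst (_ <_) (sym toℕ-slot) fy<q) (<-≤-trans fy<q (q≤toℕ f-ext x))

    drop-fixes-> : ∀ {y} → f x Fin.< f y → drop x f y ≡ f y
    drop-fixes-> fx<fy = moveTo-fixes-> (slot f x) (f x) (≤-<-trans (≤-trans (≤-reflexive toℕ-slot) (q≤toℕ f-ext x)) fx<fy) fx<fy

    toℕ-drop-self : toℕ (drop x f x) ≡ q f x
    toℕ-drop-self = trans (cong toℕ (moveTo-source (slot f x) (f x))) toℕ-slot

    q-drop : q (drop x f) x ≡ q f x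
    q-drop = q-cong x (λ y≺x → cong (suc ∘ toℕ) (drop-fixes-< (q-≥ f y≺x)))

    r-drop : r (drop x f) x ≡ r f x
    r-drop = r-cong x (λ x≺y → cong (suc ∘ toℕ) (drop-fixes-> (linExt-mono-< f-ext x≺y)))

    drop-linExt : IsLinExt (drop x f)
    drop-linExt = drop-inj , injective⇒surjective drop-inj , drop-mono
      where
      drop-inj : ∀ y w → drop x f y ≡ drop x f w → y ≡ w
      drop-inj y w = linExt-injective f-ext ∘ moveTo-injective (slot f x) (f x)
      drop-mono-< : ∀ {y w} → y ≺ w → drop x f y Fin.< drop x f w
      drop-mono-< {y} {w} y≺w with y ≟ x | w ≟ x
      ... | yes refl | yes refl = contradiction refl (proj₂ y≺w)
      ... | yes refl | no  _    = subst₂ ℕ._<_ (sym toℕ-drop-self) (cong toℕ (sym (drop-fixes-> fx<fw)))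
                                     (≤-<-trans (q≤toℕ f-ext x) fx<fw)
        where fx<fw = linExt-mono-< f-ext y≺w
      ... | no  _    | yes refl = subst₂ ℕ._<_ (cong toℕ (sym (drop-fixes-< (q-≥ f y≺w)))) (sym toℕ-drop-self) (q-≥ f y≺w)
      ... | no  y≢x  | no  w≢x  = moveTo-mono-< (slot f x) (f x) (y≢x ∘ linExt-injective f-ext ∘ sym) (w≢x ∘ linExt-injective f-ext ∘ sym)
                                     (linExt-mono-< f-ext y≺w)
      drop-mono : ∀ y w → y ≼ w → val (drop x f) y ≤ val (drop x f) w
      drop-mono y w y≼w with ≼⇒≡⊎≺ y≼w
      ... | inj₁ refl = ≤-refl
      ... | inj₂ y≺w  = s≤s (<⇒≤ (drop-mono-< y≺w))

  HighestPred : Labelling → Fin n → Fin n → Set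
  HighestPred f y z = z ≺ y × val f z ≡ q f y

  highestPred? : ∀ f y → Dec (∃ (HighestPred f y))
  highestPred? f y = Fin.any? (λ z → (z ≺? y) ×-dec (val f z ℕ.≟ q f y))

  pred⇒highestPred : ∀ f {y z} → z ≺ y → ∃ (HighestPred f y)
  pred⇒highestPred f {y} z≺y with q-attained f y
  ... | inj₁ q≡0              = contradiction (≤-trans (q-≥ f z≺y) (≤-reflexive q≡0)) λ ()
  ... | inj₂ (z′ , z′≺y , q≡) = z′ , z′≺y , sym q≡

  cascade : ℕ → Labelling → Fin n → Labelling
  cascade zero    f y = drop y f
  cascade (suc k) f y with highestPred? (drop y f) y
  ... | yes (z , _) = cascade k (drop y f) z
  ... | no  _       = drop y f

  cascade-linExt : ∀ k {f} y → IsLinExt f → IsLinExt (cascade k f y)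
  cascade-linExt zero    y f-ext = drop-linExt f-ext y
  cascade-linExt (suc k) {f} y f-ext with highestPred? (drop y f) y
  ... | yes (z , _) = cascade-linExt k z (drop-linExt f-ext y)
  ... | no  _       = drop-linExt f-ext y

  private
    highestPred-adjacent : ∀ {f} → IsLinExt f → ∀ {y z} → HighestPred (drop y f) y z →
                           suc (toℕ (drop y f z)) ≡ toℕ (drop y f y)
    highestPred-adjacent f-ext {y} (_ , f₁z≡q) = trans f₁z≡q (trans (q-drop f-ext y) (sym (toℕ-drop-self f-ext y)))

  cascade-fixes : ∀ k {f} y → IsLinExt f → ∀ {w} → toℕ (drop y f y) ≤ toℕ (drop y f w) → cascade k f y w ≡ drop y f w
  cascade-fixes zero    y f-ext _ = refl
  cascade-fixes (suc k) {f} y f-ext {w} f₁y≤f₁w with highestPred? (drop y f) y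
  ... | no  _            = refl
  ... | yes (z , hp) = trans (cascade-fixes k z f₁-ext f₂z≤f₂w) f₁w≡f₂w
    where
    f₁ = drop y f
    f₁-ext = drop-linExt f-ext y
    f₁z<f₁w : toℕ (f₁ z) < toℕ (f₁ w)
    f₁z<f₁w = ≤-trans (≤-reflexive (highestPred-adjacent f-ext hp)) f₁y≤f₁w
    f₁w≡f₂w = drop-fixes-> f₁-ext z f₁z<f₁w
    f₂z≤f₂w : toℕ (drop z f₁ z) ≤ toℕ (drop z f₁ w)
    f₂z≤f₂w = begin
      toℕ (drop z f₁ z)  ≡⟨ toℕ-drop-self f₁-ext z ⟩
      q f₁ z             ≤⟨ q≤toℕ f₁-ext z ⟩
      toℕ (f₁ z)         <⟨ f₁z<f₁w ⟩
      toℕ (f₁ w)         ≡⟨ cong toℕ f₁w≡f₂w ⟨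
      toℕ (drop z f₁ w)  ∎
      where open ≤-Reasoning

  cascade-fixes-> : ∀ k {f} y → IsLinExt f → ∀ {w} → f y Fin.< f w → cascade k f y w ≡ f w
  cascade-fixes-> k {f} y f-ext fy<fw = trans (cascade-fixes k y f-ext f₁y≤f₁w) f₁w≡fw
    where
    f₁w≡fw = drop-fixes-> f-ext y fy<fw
    f₁y≤f₁w = subst₂ _≤_ (sym (toℕ-drop-self f-ext y)) (cong toℕ (sym f₁w≡fw)) (≤-trans (q≤toℕ f-ext y) (<⇒≤ fy<fw))

  data OnGreedyChain (g : Labelling) : Fin n → Set where
    first : ∀ {w} → toℕ (g w) ≡ 0 → OnGreedyChain g w
    next  : ∀ {v w} → OnGreedyChain g v → v ≺ w → (∀ {u} → v ≺ u → g w Fin.≤ g u) → OnGreedyChain g w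

  on-chain-≗ : ∀ {g h} → g ≗ h → ∀ {w} → OnGreedyChain g w → OnGreedyChain h w
  on-chain-≗ g≗h {w} (first gw≡0)         = first (trans (cong toℕ (sym (g≗h w))) gw≡0)
  on-chain-≗ g≗h {w} (next chv v≺w w-1st) = next (on-chain-≗ g≗h chv) v≺w
    (λ {u} v≺u → subst₂ Fin._≤_ (g≗h w) (g≗h u) (w-1st v≺u))

  module _ {g} (g-ext : IsLinExt g) where

    private
      ≼∧≥⇒≡ : ∀ {v w} → v ≼ w → g w Fin.≤ g v → v ≡ w
      ≼∧≥⇒≡ v≼w gw≤gv with ≼⇒≡⊎≺ v≼w
      ... | inj₁ v≡w = v≡w
      ... | inj₂ v≺w = contradiction gw≤gv (<⇒≱ (linExt-mono-< g-ext v≺w))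

      ≤∧≥⇒≡ : ∀ {v w} → g v Fin.≤ g w → g w Fin.≤ g v → v ≡ w
      ≤∧≥⇒≡ gv≤gw gw≤gv = linExt-injective g-ext (Fin.toℕ-injective (≤-antisym gv≤gw gw≤gv))

      first-≼ : ∀ {v w} → OnGreedyChain g w → toℕ (g v) ≡ 0 → v ≼ w
      first-≼ (first gw≡0)     gv≡0 = ≼-reflexive (≤∧≥⇒≡ (≤-reflexive (trans gv≡0 (sym gw≡0))) (≤-reflexive (trans gw≡0 (sym gv≡0))))
      first-≼ (next chu u≺w _) gv≡0 = ≼-trans (first-≼ chu gv≡0) (proj₁ u≺w)

    on-chain-comparable : ∀ {w w′} → OnGreedyChain g w → OnGreedyChain g w′ → w ≼ w′ ⊎ w′ ≼ w
    on-chain-comparable (first gw≡0) ch′ = inj₁ (first-≼ ch′ gw≡0)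
    on-chain-comparable ch (first gw′≡0) = inj₂ (first-≼ ch gw′≡0)
    on-chain-comparable ch@(next chu u≺w w-1st) ch′@(next chv v≺w′ w′-1st)
      with on-chain-comparable chu chv | on-chain-comparable ch chv | on-chain-comparable chu ch′
    ... | inj₁ u≼v | w≶v | _ with ≼⇒≡⊎≺ u≼v | w≶v
    ...   | inj₁ refl | _        = inj₁ (≼-reflexive (≤∧≥⇒≡ (w-1st v≺w′) (w′-1st u≺w)))
    ...   | inj₂ _    | inj₁ w≼v = inj₁ (≼-trans w≼v (proj₁ v≺w′))
    ...   | inj₂ u≺v  | inj₂ v≼w = inj₁ (subst (_≼ _) (≼∧≥⇒≡ v≼w (w-1st u≺v)) (proj₁ v≺w′))
    on-chain-comparable (next chu u≺w w-1st) (next chv v≺w′ w′-1st) | inj₂ v≼u | _ | u≶w′ with ≼⇒≡⊎≺ v≼u | u≶w′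
    ...   | inj₁ refl | _         = inj₂ (≼-reflexive (≤∧≥⇒≡ (w′-1st u≺w) (w-1st v≺w′)))
    ...   | inj₂ _    | inj₂ w′≼u = inj₂ (≼-trans w′≼u (proj₁ u≺w))
    ...   | inj₂ v≺u  | inj₁ u≼w′ = inj₂ (subst (_≼ _) (≼∧≥⇒≡ u≼w′ (w′-1st v≺u)) (proj₁ u≺w))

  module _ {f} (f-ext : IsLinExt f) {y z} (hp : HighestPred (drop y f) y z) (k : ℕ) where

    private
      f₁-ext = drop-linExt f-ext y

    cascade-keeps-above : cascade k (drop y f) z y ≡ drop y f y
    cascade-keeps-above = cascade-fixes-> k z f₁-ext (≤-reflexive (highestPred-adjacent f-ext hp))

    cascade-earliest : ∀ {u} → z ≺ u → cascade k (drop y f) z y Fin.≤ cascade k (drop y f) z u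
    cascade-earliest z≺u = subst₂ Fin._≤_ (sym cascade-keeps-above) (sym (cascade-fixes-> k z f₁-ext f₁z<f₁u))
                             (≤-trans (≤-reflexive (sym (highestPred-adjacent f-ext hp))) f₁z<f₁u)
      where f₁z<f₁u = linExt-mono-< f₁-ext z≺u

    q-highestPred< : q f y < suc k → q (drop y f) z < k
    q-highestPred< q<1+k = ≤-trans (s≤s (q≤toℕ f₁-ext z)) (≤-trans (≤-reflexive (trans (proj₂ hp) (q-drop f-ext y))) (ℕ.s≤s⁻¹ q<1+k))

  cascade-on-chain : ∀ k {f} y → IsLinExt f → q f y < k → OnGreedyChain (cascade k f y) y
  cascade-on-chain (suc k) {f} y f-ext q<1+k with highestPred? (drop y f) y
  ... | yes (z , hp) = next (cascade-on-chain k z (drop-linExt f-ext y) (q-highestPred< f-ext hp k q<1+k)) (proj₁ hp)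
                            (cascade-earliest f-ext hp k)
  ... | no  ¬hp with q-attained (drop y f) y
  ...   | inj₁ q≡0          = first (trans (toℕ-drop-self f-ext y) (trans (sym (q-drop f-ext y)) q≡0))
  ...   | inj₂ (z , z≺y , q≡) = contradiction (z , z≺y , sym q≡) ¬hp

  private
    highestPred-unique : ∀ k {f g} y → IsLinExt f → IsLinExt g → ∀ {z z′} →
                         (hp : HighestPred (drop y f) y z) (hp′ : HighestPred (drop y g) y z′) →
                         q (drop y f) z < k → q (drop y g) z′ < k →
                         cascade k (drop y f) z ≗ cascade k (drop y g) z′ → z ≡ z′
    highestPred-unique k y f-ext g-ext {z} {z′} hp hp′ qf< qg< F≗G
      with on-chain-comparable F-ext chz chz′
      where
      F-ext = cascade-linExt k z (drop-linExt f-ext y)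
      chz   = cascade-on-chain k z (drop-linExt f-ext y) qf<
      chz′  = on-chain-≗ (sym ∘ F≗G) (cascade-on-chain k z′ (drop-linExt g-ext y) qg<)
    ... | inj₁ z≼z′ with ≼⇒≡⊎≺ z≼z′
    ...   | inj₁ z≡z′ = z≡z′
    ...   | inj₂ z≺z′ = contradiction (cascade-earliest f-ext hp k z≺z′)
                          (<⇒≱ (linExt-mono-< (cascade-linExt k z (drop-linExt f-ext y)) (proj₁ hp′)))
    highestPred-unique k y f-ext g-ext {z} {z′} hp hp′ qf< qg< F≗G | inj₂ z′≼z with ≼⇒≡⊎≺ z′≼z
    ...   | inj₁ z′≡z = sym z′≡z
    ...   | inj₂ z′≺z = contradiction (subst₂ Fin._≤_ (sym (F≗G y)) (sym (F≗G z)) (cascade-earliest g-ext hp′ k z′≺z))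
                          (<⇒≱ (linExt-mono-< (cascade-linExt k z (drop-linExt f-ext y)) (proj₁ hp)))

    undrop-highestPred : ∀ k {f g} y → IsLinExt f → IsLinExt g → ∀ {z} →
                         HighestPred (drop y f) y z → HighestPred (drop y g) y z →
                         cascade k (drop y f) z ≗ cascade k (drop y g) z →
                         drop z (drop y f) ≗ drop z (drop y g) → drop y f ≗ drop y g
    undrop-highestPred k {f} {g} y f-ext g-ext {z} hp hp′ F≗G df₁≗dg₁ = drop-cancel z df₁≗dg₁ f₁z≡g₁z q≡
      where
      f₁-ext = drop-linExt f-ext y
      g₁-ext = drop-linExt g-ext y
      f₁z≡g₁z : drop y f z ≡ drop y g z
      f₁z≡g₁z = Fin.toℕ-injective (suc-injective (begin
        suc (toℕ (drop y f z))          ≡⟨ highestPred-adjacent f-ext hp ⟩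
        toℕ (drop y f y)                ≡⟨ cong toℕ (cascade-keeps-above f-ext hp k) ⟨
        toℕ (cascade k (drop y f) z y)  ≡⟨ cong toℕ (F≗G y) ⟩
        toℕ (cascade k (drop y g) z y)  ≡⟨ cong toℕ (cascade-keeps-above g-ext hp′ k) ⟩
        toℕ (drop y g y)                ≡⟨ highestPred-adjacent g-ext hp′ ⟨
        suc (toℕ (drop y g z))          ∎))
        where open ≡-Reasoning
      q≡ : q (drop y f) z ≡ q (drop y g) z
      q≡ = trans (sym (q-drop f₁-ext z)) (trans (q-cong z (λ {w} _ → cong (suc ∘ toℕ) (df₁≗dg₁ w))) (q-drop g₁-ext z))

  cascade-injective : ∀ k {f g} y → IsLinExt f → IsLinExt g → q f y < k → q g y < k →
                      cascade k f y ≗ cascade k g y → drop y f ≗ drop y g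
  cascade-injective (suc k) {f} {g} y f-ext g-ext qf< qg< F≗G
    with highestPred? (drop y f) y | highestPred? (drop y g) y
  ... | no  _              | no  _              = F≗G
  ... | yes (z , z≺y , _)  | no  ¬hp            = contradiction (pred⇒highestPred (drop y g) z≺y) ¬hp
  ... | no  ¬hp            | yes (z , z≺y , _)  = contradiction (pred⇒highestPred (drop y f) z≺y) ¬hp
  ... | yes (z , hp)       | yes (z′ , hp′)
    with highestPred-unique k y f-ext g-ext hp hp′ (q-highestPred< f-ext hp k qf<) (q-highestPred< g-ext hp′ k qg<) F≗G
  ...   | refl = undrop-highestPred k y f-ext g-ext hp hp′ F≗G
                   (cascade-injective k z (drop-linExt f-ext y) (drop-linExt g-ext y)
                      (q-highestPred< f-ext hp k qf<) (q-highestPred< g-ext hp′ k qg<) F≗G)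

  private
    open StrictTotalOrder (×-strictTotalOrder <-strictTotalOrder (Fin.<-strictTotalOrder n))
      using (compare) renaming (_<_ to _<ₗₑₓ_; _<?_ to _<ₗₑₓ?_; trans to <ₗₑₓ-trans; irrefl to <ₗₑₓ-irrefl)

    height : Fin n → ℕ
    height x = length (filter (_≼? x) (allFin n))

    height-mono-< : ∀ {x y} → x ≺ y → height x < height y
    height-mono-< (x≼y , x≢y) = count-< (_≼? _) (_≼? _) (λ y≼x → x≢y (≼-antisym x≼y y≼x)) ≼-refl (λ z≼x → ≼-trans z≼x x≼y)

    key : Fin n → ℕ × Fin n
    key x = height x , x

    below? : ∀ x y → Dec (key y <ₗₑₓ key x)
    below? x y = key y <ₗₑₓ? key x

    rank : Fin n → ℕ
    rank x = length (filter (below? x) (allFin n))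

    rank-mono-< : ∀ {x y} → key x <ₗₑₓ key y → rank x < rank y
    rank-mono-< {x} {y} x<y = count-< (below? x) (below? y) (<ₗₑₓ-irrefl (refl , refl)) x<y (λ z<x → <ₗₑₓ-trans z<x x<y)

    rank<n : ∀ x → rank x < n
    rank<n x = ≤-trans (count-< (below? x) (λ _ → yes tt) (<ₗₑₓ-irrefl (refl , refl)) tt (λ _ → tt))
                       (≤-reflexive (trans (cong length (filter-all (λ _ → yes tt) (All.universal (λ _ → tt) (allFin n))))
                                           (length-tabulate id)))

    byRank : Labelling
    byRank x = fromℕ< (rank<n x)

    byRank-injective : ∀ x y → byRank x ≡ byRank y → x ≡ y
    byRank-injective x y rx≡ry with compare (key x) (key y) | Fin.fromℕ<-injective _ _ (rank<n x) (rank<n y) rx≡ry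
    ... | tri< x<y _ _       | rx≡ry′ = contradiction rx≡ry′ (<⇒≢ (rank-mono-< x<y))
    ... | tri≈ _ (_ , x≡y) _ | _      = x≡y
    ... | tri> _ _ y<x       | rx≡ry′ = contradiction (sym rx≡ry′) (<⇒≢ (rank-mono-< y<x))

    byRank-mono : ∀ x y → x ≼ y → val byRank x ≤ val byRank y
    byRank-mono x y x≼y with ≼⇒≡⊎≺ x≼y
    ... | inj₁ refl = ≤-refl
    ... | inj₂ x≺y  = s≤s (subst₂ _≤_ (sym (Fin.toℕ-fromℕ< (rank<n x))) (sym (Fin.toℕ-fromℕ< (rank<n y)))
                                    (<⇒≤ (rank-mono-< (inj₁ (height-mono-< x≺y)))))

  linExt-exists : ∃ IsLinExt
  linExt-exists = byRank , byRank-injective , injective⇒surjective byRank-injective , byRank-mono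

module Windows {n : ℕ} (_≼_ : Fin n → Fin n → Set) (isDPO : IsDecPartialOrder _≡_ _≼_) where
  open import Data.Nat as ℕ using (ℕ; suc; _+_; _*_; _∸_; _^_; _≤_; _<_; z≤n; s≤s; NonZero)
  open import Data.Nat.Properties
  open import Data.Fin as Fin using (Fin; toℕ)
  import Data.Fin.Properties as Fin
  open import Data.Fin.Subset using (Subset) renaming (_∈_ to _∈ₛ_)
  open import Data.Fin.Subset.Properties using (_∈?_)
  open import Data.List using (List; _∷_; map; filter; length; concatMap; applyUpTo)
  open import Data.List.Base using (allFin)
  open import Data.List.Properties using (map-cong; map-cong-local; length-map; length-applyUpTo)
  open import Data.Nat.ListAction using (sum)
  open import Data.List.Membership.Propositional.Properties using (∈-applyUpTo⁺)
  open import Data.List.Relation.Unary.All as All using (All; _∷_)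
  import Data.List.Relation.Unary.All.Properties as All
  open import Data.List.Relation.Unary.Any as Any using (Any)
  import Data.List.Relation.Unary.Any.Properties as Any
  open import Data.List.Relation.Unary.AllPairs as AllPairs using (AllPairs)
  import Data.List.Relation.Unary.AllPairs.Properties as AllPairs
  open import Data.Product using (_×_; _,_; proj₂)
  open import Data.Sum using (inj₁; inj₂)
  open import Function using (_∘_)
  open import Relation.Binary.Bundles using (DecSetoid)
  open import Relation.Binary.PropositionalEquality
  open import Relation.Nullary using (¬_)
  import Data.List.Membership.Setoid.Properties as Membership
  open import Data.List.Membership.Propositional using () renaming (_∈_ to _∈ℕ_)
  import Data.List.Relation.Unary.Unique.Setoid.Properties as Unique
  import Data.List.Relation.Unary.Unique.Propositional.Properties as UniqueP
  import Defs
  open Sums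
  open Lists
  open Enumeration
  open Rationals
  open import Defs using (ℕtoℚ; inv; sumℚ)
  import Data.Rational as ℚ
  open import Data.Nat.Solver using (module +-*-Solver)

  open LinearExtensions _≼_ isDPO
  open DecSetoid (≗-decSetoid n n) using () renaming (setoid to ≗-setoid)
  open import Data.List.Membership.Setoid ≗-setoid using (_∈_)
  open import Data.List.Relation.Unary.Unique.Setoid ≗-setoid using (Unique)
  open import Data.List.Relation.Binary.Disjoint.Setoid ≗-setoid using (Disjoint)
  open Counting (≗-decSetoid n n)

  L : List Labelling
  L = Defs.linExts _≼_ isDPO

  N : ℕ
  N = length L

  L-linExt : All IsLinExt L
  L-linExt = All.all-filter (Defs.isLinExt? _≼_ isDPO) (Defs.allFuns n n)

  L-unique : Unique L
  L-unique = Unique.filter⁺ ≗-setoid (Defs.isLinExt? _≼_ isDPO) (allFuns-unique n)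

  L-complete : ∀ {f} → IsLinExt f → f ∈ L
  L-complete f-ext = Membership.∈-filter⁺ ≗-setoid (Defs.isLinExt? _≼_ isDPO) linExt-resp-≗ (allFuns-complete n _) f-ext

  instance
    N-nonZero : NonZero N
    N-nonZero = nonempty (L-complete (proj₂ linExt-exists))
      where
      nonempty : ∀ {f xs} → Any (f ≗_) xs → NonZero (length xs)
      nonempty {xs = _ ∷ _} _ = _

  width : Fin n → Labelling → ℕ
  width x f = r f x ∸ q f x

  W : Fin n → ℕ
  W x = ∑ L (width x)

  module _ (x : Fin n) where

    -- toℕ counts from 0, so this says that x is at position q(x) + 1.
    InSlot : Labelling → Set
    InSlot f = toℕ (f x) ≡ q f x

    D : List Labelling
    D = filter (λ f → toℕ (f x) ℕ.≟ q f x) L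

    D-unique : Unique D
    D-unique = Unique.filter⁺ ≗-setoid _ L-unique

    D-invariant : All (λ f → IsLinExt f × InSlot f) D
    D-invariant = All.zip (All.filter⁺ _ L-linExt , All.all-filter _ L)

    drop-∈-D : ∀ {f} → IsLinExt f → drop x f ∈ D
    drop-∈-D f-ext = Membership.∈-filter⁺ ≗-setoid _ inSlot-resp (L-complete (drop-linExt f-ext x))
                       (trans (toℕ-drop-self f-ext x) (sym (q-drop f-ext x)))
      where
      inSlot-resp : ∀ {f g} → f ≗ g → InSlot f → InSlot g
      inSlot-resp {f} {g} f≗g fx≡q = trans (cong toℕ (sym (f≗g x))) (trans fx≡q (q-≗ x f≗g))

    m : Labelling → ℕ
    m g = length (fibre (drop x) g L)

    fibre-invariant : ∀ g → All (λ f → IsLinExt f × drop x f ≗ g) (fibre (drop x) g L)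
    fibre-invariant g = All.zip (All.filter⁺ _ L-linExt , All.all-filter _ L)

    N≡∑m : N ≡ ∑ D m
    N≡∑m = begin
      length L                                          ≡⟨ ∑-1 L ⟨
      ∑ L (λ _ → 1)                                     ≡⟨ ∑-fibres (drop x) (λ _ → 1) D-unique L (All.map drop-∈-D L-linExt) ⟩
      ∑ D (λ g → ∑ (fibre (drop x) g L) (λ _ → 1))      ≡⟨ cong sum (map-cong (λ g → ∑-1 (fibre (drop x) g L)) D) ⟩
      ∑ D m                                             ∎
      where open ≡-Reasoning

    private
      width-fibre : ∀ {f g} → IsLinExt f → drop x f ≗ g → width x f ≡ width x g
      width-fibre f-ext f₁≗g = cong₂ _∸_ (trans (sym (r-drop f-ext x)) (r-≗ x f₁≗g)) (trans (sym (q-drop f-ext x)) (q-≗ x f₁≗g))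

      ∑-fibre-width : ∀ g → ∑ (fibre (drop x) g L) (width x) ≡ m g * width x g
      ∑-fibre-width g = trans (cong sum (map-cong-local (All.map (λ (f-ext , f₁≗g) → width-fibre f-ext f₁≗g) (fibre-invariant g))))
                              (∑-const (width x g) (fibre (drop x) g L))

    W≡∑mw : W x ≡ ∑ D (λ g → m g * width x g)
    W≡∑mw = trans (∑-fibres (drop x) (width x) D-unique L (All.map drop-∈-D L-linExt)) (cong sum (map-cong ∑-fibre-width D))

    fibre-determined-by-position : ∀ {f f′ g} → IsLinExt f × drop x f ≗ g → IsLinExt f′ × drop x f′ ≗ g →
                                   toℕ (f x) ≡ toℕ (f′ x) → f ≗ f′
    fibre-determined-by-position (f-ext , f₁≗g) (f′-ext , f′₁≗g) fx≡f′x =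
      drop-cancel x f₁≗f′₁ (Fin.toℕ-injective fx≡f′x) (trans (sym (q-drop f-ext x)) (trans (q-≗ x f₁≗f′₁) (q-drop f′-ext x)))
      where f₁≗f′₁ = λ y → trans (f₁≗g y) (sym (f′₁≗g y))

    -- Distinct members of the fibre put x at distinct positions p, all with q g x ≤ p and p + 1 < r g x.
    m≤r∸1+q : ∀ {g} → IsLinExt g → m g ≤ r g x ∸ suc (q g x)
    m≤r∸1+q {g} g-ext = begin
      m g                  ≡⟨ length-map (λ f → toℕ (f x)) (fibre (drop x) g L) ⟨
      length positions     ≤⟨ ℕCounting.unique⊆⇒length≤ slots positions-unique (All.map⁺ (All.map ∈-slots (fibre-invariant g))) ⟩
      length slots         ≡⟨ length-applyUpTo (q g x +_) (r g x ∸ suc (q g x)) ⟩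
      r g x ∸ suc (q g x)  ∎
      where
      open ≤-Reasoning
      module ℕCounting = Counting ≡-decSetoid
      positions = map (λ f → toℕ (f x)) (fibre (drop x) g L)
      slots = applyUpTo (q g x +_) (r g x ∸ suc (q g x))
      positions-unique : AllPairs (λ p p′ → ¬ p ≡ p′) positions
      positions-unique = AllPairs.map⁺ (allPairs-map-under-All (λ fi f′i f≉f′ → f≉f′ ∘ fibre-determined-by-position fi f′i)
                                                               (fibre-invariant g) (Unique.filter⁺ ≗-setoid _ L-unique))
      ∈-slots : ∀ {f} → IsLinExt f × drop x f ≗ g → toℕ (f x) ∈ℕ slots
      ∈-slots {f} (f-ext , f₁≗g) = subst (_∈ℕ slots) (m+[n∸m]≡n q≤fx) (∈-applyUpTo⁺ (q g x +_) (∸-monoˡ-< fx<r (s≤s q≤fx)))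
        where
        q≤fx : q g x ≤ toℕ (f x)
        q≤fx = subst (_≤ toℕ (f x)) (trans (sym (q-drop f-ext x)) (q-≗ x f₁≗g)) (q≤toℕ f-ext x)
        fx<r : val f x < r g x
        fx<r = subst (val f x <_) (trans (sym (r-drop f-ext x)) (r-≗ x f₁≗g)) (val<r f-ext x)

    window-bound : suc n * (N * N) ≤ length D * n * W x
    window-bound = subst₂ (λ a b → suc n * (a * a) ≤ length D * n * b) (sym N≡∑m) (sym W≡∑mw)
                     (square-sum-bound n m (width x) D (All.map fibre-bounds D-invariant))
      where
      fibre-bounds : ∀ {g} → IsLinExt g × InSlot g → suc (m g) ≤ width x g × m g ≤ n
      fibre-bounds {g} (g-ext , _) = ≤-trans (s≤s (m≤r∸1+q g-ext)) (≤-reflexive (sym (+-∸-assoc 1 q<r))) ,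
                                     ≤-trans (m≤r∸1+q g-ext) (∸-mono (r≤1+n g x) (s≤s z≤n))
        where q<r = <-trans (s≤s (q≤toℕ g-ext x)) (val<r g-ext x)

  lift : Fin n → Labelling → Labelling
  lift x f = cascade n f x

  private
    q<n : ∀ {f} → IsLinExt f → ∀ x → q f x < n
    q<n {f} f-ext x = ≤-<-trans (q≤toℕ f-ext x) (Fin.toℕ<n (f x))

    lift-injective : ∀ x {f g} → IsLinExt f × InSlot x f → IsLinExt g × InSlot x g → lift x f ≗ lift x g → f ≗ g
    lift-injective x (f-ext , f-slot) (g-ext , g-slot) lf≗lg y =
      trans (sym (drop-id x f-slot y)) (trans (cascade-injective n x f-ext g-ext (q<n f-ext x) (q<n g-ext x) lf≗lg y) (drop-id x g-slot y))

    image-on-chain : ∀ {x v} → v ∈ map (lift x) (D x) → IsLinExt v × OnGreedyChain v x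
    image-on-chain {x} v∈ with (f-ext , _) , v≗lf ← All.lookupAny (D-invariant x) (Any.map⁻ v∈) =
      linExt-resp-≗ (sym ∘ v≗lf) (cascade-linExt n x f-ext) , on-chain-≗ (sym ∘ v≗lf) (cascade-on-chain n x f-ext (q<n f-ext x))

  module Antichain (A : Subset n) (A-antichain : Defs.IsAntichain _≼_ isDPO A) where

    elements : List (Fin n)
    elements = filter (_∈? A) (allFin n)

    private
      images : List Labelling
      images = concatMap (λ x → map (lift x) (D x)) elements

      image-unique : ∀ x → Unique (map (lift x) (D x))
      image-unique x = AllPairs.map⁺ (allPairs-map-under-All (λ fi gi f≉g → f≉g ∘ lift-injective x fi gi) (D-invariant x) (D-unique x))

      -- Each element of A lies on the greedy chain of its images, and chains meet an antichain at most once.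
      images-disjoint : ∀ {x x′} → x ∈ₛ A → x′ ∈ₛ A → x ≢ x′ → Disjoint (map (lift x) (D x)) (map (lift x′) (D x′))
      images-disjoint {x} {x′} x∈A x′∈A x≢x′ (v∈ , v∈′) with image-on-chain v∈ | image-on-chain v∈′
      ... | v-ext , chx | _ , chx′ with on-chain-comparable v-ext chx chx′
      ...   | inj₁ x≼x′ = x≢x′ (A-antichain x x′ x∈A x′∈A x≼x′)
      ...   | inj₂ x′≼x = x≢x′ (sym (A-antichain x′ x x′∈A x∈A x′≼x))

      images-unique : Unique images
      images-unique = Unique.concat⁺ ≗-setoid (All.map⁺ (All.universal image-unique elements))
        (AllPairs.map⁺ (allPairs-map-under-All images-disjoint (All.all-filter (_∈? A) (allFin n))
                                                                (AllPairs.filter⁺ (_∈? A) (UniqueP.allFin⁺ n))))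

      images-⊆L : All (_∈ L) images
      images-⊆L = All.concat⁺ (All.map⁺ (All.universal image-⊆L elements))
        where
        image-⊆L : ∀ x → All (_∈ L) (map (lift x) (D x))
        image-⊆L x = All.map⁺ (All.map (λ (f-ext , _) → L-complete (cascade-linExt n x f-ext)) (D-invariant x))

    ∑|D|≤N : ∑ elements (length ∘ D) ≤ N
    ∑|D|≤N = subst (_≤ N) (trans (length-concatMap _ elements) (cong sum (map-cong (λ x → length-map (lift x) (D x)) elements)))
               (unique⊆⇒length≤ L images-unique images-⊆L)

    total-width : ℕ
    total-width = ∑ elements W

    count-bound : suc n * (length elements * length elements) * N ≤ total-width * n
    count-bound = *-cancelˡ-≤ N (begin
      N * (suc n * (k * k) * N)                            ≡⟨ solve 3 (λ n k N → N :* ((con 1 :+ n) :* (k :* k) :* N)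
                                                                                 := (con 1 :+ n) :* (N :* N) :* (k :* k)) refl n k N ⟩
      C * (k * k)                                          ≡⟨ cong (λ c → C * (c * c)) (∑-1 elements) ⟨
      C * (∑ elements (λ _ → 1) * ∑ elements (λ _ → 1))    ≤⟨ cauchy-schwarz C (length ∘ D) (λ x → n * W x) (λ _ → 1) elements
                                                                (All.universal window-bound′ elements) ⟩
      ∑ elements (length ∘ D) * ∑ elements (λ x → n * W x) ≤⟨ *-monoˡ-≤ _ ∑|D|≤N ⟩
      N * ∑ elements (λ x → n * W x)                       ≡⟨ cong (N *_) (trans (∑-*ˡ n W elements) (*-comm n total-width)) ⟩
      N * (total-width * n)                                ∎)
      where
      open ≤-Reasoning
      open +-*-Solver
      k = length elements
      C = suc n * (N * N)
      window-bound′ : ∀ x → C * (1 * 1) ≤ length (D x) * (n * W x)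
      window-bound′ x = subst₂ _≤_ (sym (*-identityʳ C)) (*-assoc (length (D x)) n (W x)) (window-bound x)

    sumWin≡ : Defs.sumWin _≼_ isDPO A ≡ ℕtoℚ total-width ℚ.* inv N
    sumWin≡ = begin
      sumℚ (map (Defs.win _≼_ isDPO) elements)                ≡⟨ cong sumℚ (map-cong win≡ elements) ⟩
      sumℚ (map (λ x → ℕtoℚ (W x) ℚ.* inv N) elements)        ≡⟨ sumℚ-*ʳ (ℕtoℚ ∘ W) (inv N) elements ⟩
      sumℚ (map (ℕtoℚ ∘ W) elements) ℚ.* inv N               ≡⟨ cong (ℚ._* inv N) (sumℚ-ℕtoℚ W elements) ⟩
      ℕtoℚ total-width ℚ.* inv N                             ∎
      where
      open ≡-Reasoning
      win≡ : ∀ x → Defs.win _≼_ isDPO x ≡ ℕtoℚ (W x) ℚ.* inv N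
      win≡ x = cong (ℚ._* inv N) (trans (cong sumℚ (map-cong-local (All.map (λ f-ext → sym (ℕtoℚ-∸ _ _ (q≤r f-ext))) L-linExt)))
                                        (sumℚ-ℕtoℚ (width x) L))
        where
        q≤r : ∀ {f} → IsLinExt f → q f x ≤ r f x
        q≤r f-ext = ≤-trans (q≤toℕ f-ext x) (<⇒≤ (<-trans (n<1+n _) (val<r f-ext x)))

open import Defs using (IsAntichain; sumWin; ℕtoℚ; inv)
open import Data.Nat using (suc; _*_; _^_; NonZero)
open import Data.Nat.Properties using (*-identityʳ)
open import Data.Fin.Subset using (Subset; ∣_∣)
open import Data.Integer using (+_)
open import Data.List using (length)
open import Data.Rational using (_≤_; _/_)
import Data.Rational as ℚ
open import Data.Rational.Properties using (module ≤-Reasoning)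
open import Relation.Binary.PropositionalEquality using (cong; trans)
open Enumeration using (∣p∣≡count-∈)
open Rationals using (+/≤ℕtoℚ*inv)

theorem2p9 : (n : ℕ) .{{_ : NonZero n}} (_≼_ : Fin n → Fin n → Set)
    (isDPO : IsDecPartialOrder _≡_ _≼_) (A : Subset n) →
    IsAntichain _≼_ isDPO A →
    (+ (suc n * ∣ A ∣ ^ 2)) / n ≤ sumWin _≼_ isDPO A
theorem2p9 n _≼_ isDPO A A-antichain = begin
  + (suc n * ∣ A ∣ ^ 2) / n       ≡⟨ cong (λ c → + (suc n * c) / n) ∣A∣²≡k*k ⟩
  + (suc n * (k * k)) / n         ≤⟨ +/≤ℕtoℚ*inv (suc n * (k * k)) n total-width N count-bound ⟩
  ℕtoℚ total-width ℚ.* inv N      ≡⟨ sumWin≡ ⟨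
  sumWin _≼_ isDPO A              ∎
  where
  open ≤-Reasoning
  open Windows _≼_ isDPO
  open Antichain A A-antichain
  k = length elements
  ∣A∣²≡k*k : ∣ A ∣ ^ 2 ≡ k * k
  ∣A∣²≡k*k = trans (cong (∣ A ∣ *_) (*-identityʳ ∣ A ∣)) (cong (λ c → c * c) (∣p∣≡count-∈ A))
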